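{- Let $\sigma,\gamma\in\mathfrak{S}_n$ be such that $(\sigma,\gamma)$ is an allowable pair. Then there exist $k\ge2$ and a standard composition tableau $\tau$ of shape $(k^n)$ such that $\mathrm{st}_{k-1}(\tau)=\sigma$ and $\mathrm{st}_k(\tau)=\gamma$.
   Context: For $\sigma,\gamma\in\mathfrak{S}_n$, the pair $(\sigma,\gamma)$ is allowable if (a) for all $1\le i<j\le n$, $\sigma(i)>\sigma(j)$ implies $\gamma(i)>\gamma(j)$, and (b) for all $1\le i<j<l\le n$ with $\sigma(i)<\sigma(j)<\sigma(l)$, it is not the case that $\gamma(j)<\gamma(l)<\gamma(i)$. A standard composition tableau of shape $(k^n)$ is a filling $\tau$ of the $n\times k$ array ($n$ rows, each with $k$ cells) with the distinct integers $1,\dots,kn$ such that: the first column increases from top to bottom; rows decrease from left to right; and (triple condition) whenever $i<r$ and the cells $(i,j),(i,j+1),(r,j+1)$ have entries $a,b,c$, $a\ge c$ implies $b>c$. For $1\le j\le k$, $\mathrm{st}_j(\tau)\in\mathfrak{S}_n$ is the standardization of the $j$-th column read top to bottom, i.e. the unique $\pi\in\mathfrak{S}_n$ with $\pi(i)>\pi(r)$ iff the entry of row $i$ exceeds that of row $r$ in column $j$. -}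

module Defs where

open import Data.Nat as ℕ using (ℕ; zero; suc; _*_)
open import Data.Fin as Fin using (Fin; zero; suc; toℕ)
open import Data.Fin.Permutation using (Permutation′; _⟨$⟩ʳ_)
open import Data.Product using (_×_)
open import Relation.Binary.PropositionalEquality using (_≡_)
open import Relation.Nullary using (¬_)
open import Function.Bundles using (_⇔_)

Allowable : {n : ℕ} → Permutation′ n → Permutation′ n → Set
Allowable {n} σ γ =
  ((i j : Fin n) → i Fin.< j → (σ ⟨$⟩ʳ j) Fin.< (σ ⟨$⟩ʳ i) → (γ ⟨$⟩ʳ j) Fin.< (γ ⟨$⟩ʳ i))
  × ((i j l : Fin n) → i Fin.< j → j Fin.< l →
       (σ ⟨$⟩ʳ i) Fin.< (σ ⟨$⟩ʳ j) → (σ ⟨$⟩ʳ j) Fin.< (σ ⟨$⟩ʳ l) →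
       ¬ (((γ ⟨$⟩ʳ j) Fin.< (γ ⟨$⟩ʳ l)) × ((γ ⟨$⟩ʳ l) Fin.< (γ ⟨$⟩ʳ i))))

-- A filling of the n × k array: τ i j is the entry in row i, column j (0-indexed).
Filling : ℕ → ℕ → Set
Filling n k = Fin n → Fin k → ℕ

record IsSCT {n k : ℕ} (τ : Filling n k) : Set where
  field
    distinct : (i r : Fin n) (j s : Fin k) → τ i j ≡ τ r s → (i ≡ r) × (j ≡ s)
    range    : (i : Fin n) (j : Fin k) → 1 ℕ.≤ τ i j × τ i j ℕ.≤ k * n
    firstCol : (i r : Fin n) (c : Fin k) → toℕ c ≡ 0 → i Fin.< r → τ i c ℕ.< τ r c
    rowDec   : (i : Fin n) (j j' : Fin k) → toℕ j' ≡ suc (toℕ j) → τ i j' ℕ.< τ i j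
    triple   : (i r : Fin n) (j j' : Fin k) → toℕ j' ≡ suc (toℕ j) → i Fin.< r →
               τ r j' ℕ.≤ τ i j → τ r j' ℕ.< τ i j'

IsStd : {n k : ℕ} → Filling n k → Fin k → Permutation′ n → Set
IsStd {n} τ j π = (i r : Fin n) → ((π ⟨$⟩ʳ r) Fin.< (π ⟨$⟩ʳ i)) ⇔ (τ r j ℕ.< τ i j)

-- Take k = n + 2 columns and give cell (i, j) a key: the weight (n + i, 0) on and below the diagonal
-- (j ≤ i), the weight (L i, σ i + 1) above it in columns j ≤ n, where L i = max {γ i' ∣ σ i' ≤ σ i},
-- and the weight (γ i, 0) in the last column; ties are broken by the column. Replacing every key by its
-- rank among all k n keys yields a filling by 1, …, k n with the same relative order. Since L is
-- monotone along σ, column n is ordered by σ and column n + 1 by γ, and all tableau conditions follow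
-- from the shape of the keys except the triple condition between the last two columns. There it
-- demands L i < γ r whenever i < r and γ i < γ r, which is exactly what allowability of (σ, γ) gives.

module Submission where

open import Defs
import Data.Nat.Properties as ℕ
open import Algebra.Properties.Monoid.Sum ℕ.+-0-monoid using (sum; sum-syntax)
open import Data.Bool.Base using (if_then_else_)
open import Data.Empty using (⊥-elim)
open import Data.Fin as Fin using (Fin; toℕ)
import Data.Fin.Properties as Fin
open import Data.Fin.Permutation using (Permutation′; _⟨$⟩ʳ_)
open import Data.Nat using (ℕ; zero; suc; _+_; _*_; _≤_; _<_; _⊔_; z≤n; s≤s; s≤s⁻¹)
open import Data.Product using (Σ; _×_; _,_; proj₁; proj₂)
open import Data.Product.Relation.Binary.Lex.Strict using (×-strictTotalOrder)
open import Data.Sum as Sum using (_⊎_; inj₁; inj₂)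
open import Data.Vec.Functional using (Vector; head; tail)
open import Function using (_∘_; const)
open import Function.Bundles using (Injection; mk⇔)
open import Function.Properties.Inverse using (↔⇒↣)
open import Level using (0ℓ)
open import Relation.Binary using (StrictTotalOrder; tri<; tri≈; tri>)
import Relation.Binary.Construct.Flip.EqAndOrd as Flip
open import Relation.Binary.PropositionalEquality using (_≡_; _≢_; refl; cong; sym; trans; subst; subst₂)
open import Relation.Nullary using (yes; no; does)
open import Relation.Unary using (Pred; Decidable)

⟨$⟩ʳ-injective : ∀ {n} (π : Permutation′ n) {i r} → π ⟨$⟩ʳ i ≡ π ⟨$⟩ʳ r → i ≡ r
⟨$⟩ʳ-injective π = Injection.injective (↔⇒↣ π)

sum-mono-≤ : ∀ {m} {f g : Vector ℕ m} → (∀ i → f i ≤ g i) → sum f ≤ sum g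
sum-mono-≤ {zero}  f≤g = z≤n
sum-mono-≤ {suc m} f≤g = ℕ.+-mono-≤ (f≤g Fin.zero) (sum-mono-≤ (f≤g ∘ Fin.suc))

sum-mono-< : ∀ {m} {f g : Vector ℕ m} → (∀ i → f i ≤ g i) → ∀ x → f x < g x → sum f < sum g
sum-mono-< {suc m} f≤g Fin.zero    fx<gx = ℕ.+-mono-<-≤ fx<gx (sum-mono-≤ (f≤g ∘ Fin.suc))
sum-mono-< {suc m} f≤g (Fin.suc x) fx<gx = ℕ.+-mono-≤-< (f≤g Fin.zero) (sum-mono-< (f≤g ∘ Fin.suc) x fx<gx)

sum-sum-mono-< : ∀ {m l} {f g : Fin m → Fin l → ℕ} → (∀ i j → f i j ≤ g i j) → ∀ i j → f i j < g i j →
                 ∑[ i < m ] ∑[ j < l ] f i j < ∑[ i < m ] ∑[ j < l ] g i j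
sum-sum-mono-< f≤g i j fij<gij = sum-mono-< (sum-mono-≤ ∘ f≤g) i (sum-mono-< (f≤g i) j fij<gij)

sum-const : ∀ m c → sum {m} (const c) ≡ m * c
sum-const zero    c = refl
sum-const (suc m) c = cong (c +_) (sum-const m c)

maxWhere : ∀ {m ℓ} {P : Pred (Fin m) ℓ} → Decidable P → Vector ℕ m → ℕ
maxWhere {zero}  P? f = 0
maxWhere {suc m} P? f = (if does (P? Fin.zero) then head f else 0) ⊔ maxWhere (P? ∘ Fin.suc) (tail f)

≤-maxWhere : ∀ {m ℓ} {P : Pred (Fin m) ℓ} (P? : Decidable P) (f : Vector ℕ m) {i} → P i → f i ≤ maxWhere P? f
≤-maxWhere P? f {Fin.zero} Pi with P? Fin.zero
... | yes _  = ℕ.m≤m⊔n _ _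
... | no ¬Pi = ⊥-elim (¬Pi Pi)
≤-maxWhere P? f {Fin.suc i} Pi =
  ℕ.≤-trans (≤-maxWhere (P? ∘ Fin.suc) (tail f) Pi) (ℕ.m≤n⊔m _ _)

maxWhere-lub : ∀ {m ℓ} {P : Pred (Fin m) ℓ} (P? : Decidable P) (f : Vector ℕ m) {x} →
               (∀ i → P i → f i ≤ x) → maxWhere P? f ≤ x
maxWhere-lub {zero}  P? f f≤x = z≤n
maxWhere-lub {suc m} P? f {x} f≤x = ℕ.⊔-lub head≤x (maxWhere-lub (P? ∘ Fin.suc) (tail f) (f≤x ∘ Fin.suc))
  where
  head≤x : (if does (P? Fin.zero) then head f else 0) ≤ x
  head≤x with P? Fin.zero
  ... | yes P0 = f≤x Fin.zero P0
  ... | no _   = z≤n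

maxWhere-< : ∀ {m ℓ} {P : Pred (Fin m) ℓ} (P? : Decidable P) (f : Vector ℕ m) {x} → 0 < x →
             (∀ i → P i → f i < x) → maxWhere P? f < x
maxWhere-< P? f {suc x} _ f<x = s≤s (maxWhere-lub P? f (λ i Pi → s≤s⁻¹ (f<x i Pi)))

module Standardization {a ℓ₁ ℓ₂} (O : StrictTotalOrder a ℓ₁ ℓ₂) where

  open StrictTotalOrder O using (_≈_; compare; module Eq)
    renaming (Carrier to A; _<_ to _≺_; _<?_ to _≺?_; trans to ≺-trans; irrefl to ≺-irrefl)

  below : A → A → ℕ
  below x v with x ≺? v
  ... | yes _ = 1
  ... | no _  = 0

  below-mono : ∀ x {v w} → v ≺ w → below x v ≤ below x w
  below-mono x {v} {w} v≺w with x ≺? v | x ≺? w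
  ... | yes _   | yes _   = ℕ.≤-refl
  ... | yes x≺v | no x⊀w = ⊥-elim (x⊀w (≺-trans x≺v v≺w))
  ... | no _    | _       = z≤n

  below-irrefl : ∀ x → below x x ≡ 0
  below-irrefl x with x ≺? x
  ... | yes x≺x = ⊥-elim (≺-irrefl Eq.refl x≺x)
  ... | no _    = refl

  below-≺ : ∀ {x v} → x ≺ v → below x v ≡ 1
  below-≺ {x} {v} x≺v with x ≺? v
  ... | yes _   = refl
  ... | no x⊀v = ⊥-elim (x⊀v x≺v)

  below≤1 : ∀ x v → below x v ≤ 1
  below≤1 x v with x ≺? v
  ... | yes _ = ℕ.≤-refl
  ... | no _  = z≤n

  module _ {n k : ℕ} (K : Fin n → Fin k → A) where

    countBelow : A → ℕ
    countBelow v = ∑[ i < n ] ∑[ j < k ] below (K i j) v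

    standardize : Filling n k
    standardize i j = suc (countBelow (K i j))

    countBelow-≺ : ∀ i j {w} → K i j ≺ w → countBelow (K i j) < countBelow w
    countBelow-≺ i j Kij≺w = sum-sum-mono-< (λ i' j' → below-mono (K i' j') Kij≺w) i j
      (subst₂ _<_ (sym (below-irrefl (K i j))) (sym (below-≺ Kij≺w)) ℕ.0<1+n)

    countBelow-<-size : ∀ i j → countBelow (K i j) < k * n
    countBelow-<-size i j = begin-strict
      countBelow (K i j)      <⟨ sum-sum-mono-< (λ i' j' → below≤1 (K i' j') (K i j)) i j
                                   (subst (_< 1) (sym (below-irrefl (K i j))) ℕ.0<1+n) ⟩
      ∑[ i < n ] ∑[ j < k ] 1 ≡⟨ sum-const n _ ⟩
      n * ∑[ j < k ] 1        ≡⟨ cong (n *_) (sum-const k 1) ⟩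
      n * (k * 1)             ≡⟨ cong (n *_) (ℕ.*-identityʳ k) ⟩
      n * k                   ≡⟨ ℕ.*-comm n k ⟩
      k * n                   ∎
      where open ℕ.≤-Reasoning

    standardize-≺ : ∀ {i j r s} → K i j ≺ K r s → standardize i j < standardize r s
    standardize-≺ {i} {j} = s≤s ∘ countBelow-≺ i j

    standardize-injective : ∀ {i j r s} → standardize i j ≡ standardize r s → K i j ≈ K r s
    standardize-injective {i} {j} {r} {s} τij≡τrs with compare (K i j) (K r s)
    ... | tri< Kij≺Krs _ _ = ⊥-elim (ℕ.<-irrefl τij≡τrs (standardize-≺ Kij≺Krs))
    ... | tri≈ _ Kij≈Krs _ = Kij≈Krs
    ... | tri> _ _ Krs≺Kij = ⊥-elim (ℕ.<-irrefl (sym τij≡τrs) (standardize-≺ Krs≺Kij))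

    standardize-range : ∀ i j → 1 ≤ standardize i j × standardize i j ≤ k * n
    standardize-range i j = s≤s z≤n , countBelow-<-size i j

    standardize-isStd : (π : Permutation′ n) (a : Fin k) →
                        (∀ {r i} → π ⟨$⟩ʳ r Fin.< π ⟨$⟩ʳ i → K r a ≺ K i a) → IsStd standardize a π
    standardize-isStd π a increasing i r = mk⇔ (standardize-≺ ∘ increasing) reflects
      where
      reflects : standardize r a < standardize i a → π ⟨$⟩ʳ r Fin.< π ⟨$⟩ʳ i
      reflects τra<τia with Fin.<-cmp (π ⟨$⟩ʳ r) (π ⟨$⟩ʳ i)
      ... | tri< πr<πi _ _ = πr<πi
      ... | tri≈ _ πr≡πi _ =
        ⊥-elim (ℕ.<-irrefl (cong (λ x → standardize x a) (⟨$⟩ʳ-injective π πr≡πi)) τra<τia)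
      ... | tri> _ _ πi<πr = ⊥-elim (ℕ.<-asym τra<τia (standardize-≺ (increasing πi<πr)))

module AllowablePair {n : ℕ} (σ γ : Permutation′ n) (allowable : Allowable σ γ) where

  allowable-ascent : ∀ {i r} → i Fin.< r → γ ⟨$⟩ʳ i Fin.< γ ⟨$⟩ʳ r → σ ⟨$⟩ʳ i Fin.< σ ⟨$⟩ʳ r
  allowable-ascent {i} {r} i<r γi<γr with Fin.<-cmp (σ ⟨$⟩ʳ i) (σ ⟨$⟩ʳ r)
  ... | tri< σi<σr _ _ = σi<σr
  ... | tri≈ _ σi≡σr _ = ⊥-elim (Fin.<⇒≢ i<r (⟨$⟩ʳ-injective σ σi≡σr))
  ... | tri> _ _ σr<σi = ⊥-elim (Fin.<-asym γi<γr (proj₁ allowable i r i<r σr<σi))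

  allowable-dominance : ∀ {i r i'} → i Fin.< r → γ ⟨$⟩ʳ i Fin.< γ ⟨$⟩ʳ r →
                        σ ⟨$⟩ʳ i' Fin.≤ σ ⟨$⟩ʳ i → γ ⟨$⟩ʳ i' Fin.< γ ⟨$⟩ʳ r
  allowable-dominance {i} {r} {i'} i<r γi<γr σi'≤σi with Fin.<-cmp (γ ⟨$⟩ʳ i') (γ ⟨$⟩ʳ r)
  ... | tri< γi'<γr _ _ = γi'<γr
  ... | tri≈ _ γi'≡γr _ with ⟨$⟩ʳ-injective γ γi'≡γr
  ...   | refl = ⊥-elim (ℕ.<⇒≱ (allowable-ascent i<r γi<γr) σi'≤σi)
  allowable-dominance {i} {r} {i'} i<r γi<γr σi'≤σi | tri> _ _ γr<γi' with Fin.<-cmp i' i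
  ... | tri≈ _ refl _ = ⊥-elim (Fin.<-asym γi<γr γr<γi')
  ... | tri> _ _ i<i' = ⊥-elim (Fin.<-asym (Fin.<-trans γi<γr γr<γi') (proj₁ allowable i i' i<i' σi'<σi))
    where
    σi'<σi : σ ⟨$⟩ʳ i' Fin.< σ ⟨$⟩ʳ i
    σi'<σi = Fin.≤∧≢⇒< σi'≤σi ((Fin.<⇒≢ i<i' ∘ sym) ∘ ⟨$⟩ʳ-injective σ)
  ... | tri< i'<i _ _ =
    ⊥-elim (proj₂ allowable i' i r i'<i i<r σi'<σi (allowable-ascent i<r γi<γr) (γi<γr , γr<γi'))
    where
    σi'<σi : σ ⟨$⟩ʳ i' Fin.< σ ⟨$⟩ʳ i
    σi'<σi = Fin.≤∧≢⇒< σi'≤σi (Fin.<⇒≢ i'<i ∘ ⟨$⟩ʳ-injective σ)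

Weight : Set
Weight = ℕ × ℕ

weightOrder : StrictTotalOrder 0ℓ 0ℓ 0ℓ
weightOrder = ×-strictTotalOrder ℕ.<-strictTotalOrder ℕ.<-strictTotalOrder

Key : Set
Key = Weight × ℕ

-- Among keys of equal weight, the one in the later column is the smaller.
keyOrder : StrictTotalOrder 0ℓ 0ℓ 0ℓ
keyOrder = ×-strictTotalOrder weightOrder (Flip.strictTotalOrder ℕ.<-strictTotalOrder)

open StrictTotalOrder weightOrder using () renaming (_<_ to _<ʷ_; _≈_ to _≋ʷ_)
open StrictTotalOrder keyOrder using () renaming (_<_ to _≺_; _≈_ to _≈ᵏ_)
open Standardization keyOrder

<ʷ-by-second : ∀ {a a' b b'} → a ≤ a' → b < b' → (a , b) <ʷ (a' , b')
<ʷ-by-second a≤a' b<b' with ℕ.m≤n⇒m<n∨m≡n a≤a'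
... | inj₁ a<a'  = inj₁ a<a'
... | inj₂ refl = inj₂ (refl , b<b')

≺-by-weight : ∀ {w w' j j'} → w <ʷ w' → (w , j) ≺ (w' , j')
≺-by-weight = inj₁

≺-by-column : ∀ {w j j'} → j' < j → (w , j) ≺ (w , j')
≺-by-column j'<j = inj₂ ((refl , refl) , j'<j)

module Tableau {n : ℕ} (σ γ : Permutation′ n) (allowable : Allowable σ γ) where

  open AllowablePair σ γ allowable

  k : ℕ
  k = suc (suc n)

  s g : Fin n → ℕ
  s i = toℕ (σ ⟨$⟩ʳ i)
  g i = toℕ (γ ⟨$⟩ʳ i)

  L : Fin n → ℕ
  L i = maxWhere (λ i' → σ ⟨$⟩ʳ i' Fin.≤? σ ⟨$⟩ʳ i) g

  g≤L : ∀ i → g i ≤ L i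
  g≤L i = ≤-maxWhere _ g {i} ℕ.≤-refl

  L-mono : ∀ {i r} → s i ≤ s r → L i ≤ L r
  L-mono {i} {r} si≤sr = maxWhere-lub _ g (λ i' si'≤si → ≤-maxWhere _ g (ℕ.≤-trans si'≤si si≤sr))

  L<n : ∀ i → L i < n
  L<n i = maxWhere-< _ g (ℕ.≤-<-trans z≤n (Fin.toℕ<n i)) (λ i' _ → Fin.toℕ<n (γ ⟨$⟩ʳ i'))

  L<g : ∀ {i r} → i Fin.< r → g i < g r → L i < g r
  L<g i<r gi<gr = maxWhere-< _ g (ℕ.≤-<-trans z≤n gi<gr) (λ i' → allowable-dominance i<r gi<gr)

  data Region (i : Fin n) (j : Fin k) : Set where
    lower : toℕ j ≤ toℕ i → Region i j
    upper : toℕ i < toℕ j → toℕ j ≤ n → Region i j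
    last  : toℕ j ≡ suc n → Region i j

  region : ∀ i j → Region i j
  region i j with toℕ j ℕ.≤? toℕ i | toℕ j ℕ.≤? n
  ... | yes j≤i | _       = lower j≤i
  ... | no j≰i  | yes j≤n = upper (ℕ.≰⇒> j≰i) j≤n
  ... | no _    | no j≰n  = last (ℕ.≤-antisym (Fin.toℕ≤pred[n] j) (ℕ.≰⇒> j≰n))

  weight : ∀ {i j} → Region i j → Weight
  weight {i} (lower _)   = n + toℕ i , 0
  weight {i} (upper _ _) = L i , suc (s i)
  weight {i} (last _)    = g i , 0

  key : Fin n → Fin k → Key
  key i j = weight (region i j) , toℕ j

  weight-lower : ∀ {i j} → toℕ j ≤ toℕ i → weight (region i j) ≡ (n + toℕ i , 0)
  weight-lower {i} {j} j≤i with region i j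
  ... | lower _      = refl
  ... | upper i<j _  = ⊥-elim (ℕ.<⇒≱ i<j j≤i)
  ... | last j≡1+n = ⊥-elim (ℕ.1+n≰n (subst (_≤ n) j≡1+n (ℕ.≤-trans j≤i (ℕ.<⇒≤ (Fin.toℕ<n i)))))

  weight-upper : ∀ {i j} → toℕ i < toℕ j → toℕ j ≤ n → weight (region i j) ≡ (L i , suc (s i))
  weight-upper {i} {j} i<j j≤n with region i j
  ... | lower j≤i   = ⊥-elim (ℕ.<⇒≱ i<j j≤i)
  ... | upper _ _   = refl
  ... | last j≡1+n = ⊥-elim (ℕ.1+n≰n (subst (_≤ n) j≡1+n j≤n))

  weight-last : ∀ {i j} → toℕ j ≡ suc n → weight (region i j) ≡ (g i , 0)
  weight-last {i} {j} j≡1+n with region i j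
  ... | lower j≤i = ⊥-elim (ℕ.1+n≰n (subst (_≤ n) j≡1+n (ℕ.≤-trans j≤i (ℕ.<⇒≤ (Fin.toℕ<n i)))))
  ... | upper _ j≤n = ⊥-elim (ℕ.1+n≰n (subst (_≤ n) j≡1+n j≤n))
  ... | last _ = refl

  <n⇒<n+ : ∀ m {x} → x < n → x < n + m
  <n⇒<n+ m x<n = ℕ.<-≤-trans x<n (ℕ.m≤m+n n m)

  <n⇒≢n+ : ∀ m {x} → x < n → x ≢ n + m
  <n⇒≢n+ m x<n = ℕ.<⇒≢ (<n⇒<n+ m x<n)

  weight-<ʷ-lower : ∀ {i r : Fin n} {j : Fin k} → i Fin.< r → (ρ : Region i j) → weight ρ <ʷ (n + toℕ r , 0)
  weight-<ʷ-lower i<r (lower _)          = inj₁ (ℕ.+-monoʳ-< n i<r)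
  weight-<ʷ-lower {i} {r} _ (upper _ _) = inj₁ (<n⇒<n+ (toℕ r) (L<n i))
  weight-<ʷ-lower {i} {r} _ (last _)    = inj₁ (<n⇒<n+ (toℕ r) (Fin.toℕ<n (γ ⟨$⟩ʳ i)))

  upperWeight-< : ∀ {i r} → s i < s r → (L i , suc (s i)) <ʷ (L r , suc (s r))
  upperWeight-< si<sr = <ʷ-by-second (L-mono (ℕ.<⇒≤ si<sr)) (s≤s si<sr)

  weight-injective : ∀ {i r j} (ρ : Region i j) (ρ' : Region r j) → weight ρ ≋ʷ weight ρ' → i ≡ r
  weight-injective {i} {r} (lower _) (lower _) (e , _) = Fin.toℕ-injective (ℕ.+-cancelˡ-≡ n _ _ e)
  weight-injective (upper _ _) (upper _ _) (_ , e) = ⟨$⟩ʳ-injective σ (Fin.toℕ-injective (ℕ.suc-injective e))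
  weight-injective (last _) (last _) (e , _) = ⟨$⟩ʳ-injective γ (Fin.toℕ-injective e)
  weight-injective {i} (lower _) (upper _ _) (e , _) = ⊥-elim (<n⇒≢n+ (toℕ i) (L<n _) (sym e))
  weight-injective {i} (lower _) (last _) (e , _) = ⊥-elim (<n⇒≢n+ (toℕ i) (Fin.toℕ<n (γ ⟨$⟩ʳ _)) (sym e))
  weight-injective {r = r} (upper _ _) (lower _) (e , _) = ⊥-elim (<n⇒≢n+ (toℕ r) (L<n _) e)
  weight-injective {r = r} (last _) (lower _) (e , _) = ⊥-elim (<n⇒≢n+ (toℕ r) (Fin.toℕ<n (γ ⟨$⟩ʳ _)) e)
  weight-injective (upper _ _) (last _) (_ , ())
  weight-injective (last _) (upper _ _) (_ , ())

  key-injective : ∀ {i j r t} → key i j ≈ᵏ key r t → i ≡ r × j ≡ t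
  key-injective {i} {j} {r} {t} (wij≋wrt , j≡t) with Fin.toℕ-injective j≡t
  ... | refl = weight-injective (region i j) (region r j) wij≋wrt , refl

  key-firstCol : ∀ {i r c} → toℕ c ≡ 0 → i Fin.< r → key i c ≺ key r c
  key-firstCol {i} {r} {c} c≡0 i<r
    rewrite weight-lower {i} {c} (subst (_≤ toℕ i) (sym c≡0) z≤n)
          | weight-lower {r} {c} (subst (_≤ toℕ r) (sym c≡0) z≤n) =
    ≺-by-weight (inj₁ (ℕ.+-monoʳ-< n i<r))

  key-rowDec : ∀ i {j j'} → toℕ j' ≡ suc (toℕ j) → key i j' ≺ key i j
  key-rowDec i {j} {j'} j'≡1+j with region i j | region i j'
  ... | last j≡1+n  | _          = ⊥-elim (ℕ.<⇒≢ (Fin.toℕ<n j') (trans j'≡1+j (cong suc j≡1+n)))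
  ... | upper i<j _ | lower j'≤i = ⊥-elim (ℕ.<⇒≱ (ℕ.<-trans i<j j<j') j'≤i)
    where
    j<j' : toℕ j < toℕ j'
    j<j' = ℕ.≤-reflexive (sym j'≡1+j)
  ... | lower _     | lower _    = ≺-by-column (ℕ.≤-reflexive (sym j'≡1+j))
  ... | lower _     | upper _ _  = ≺-by-weight (inj₁ (<n⇒<n+ (toℕ i) (L<n i)))
  ... | lower _     | last _     = ≺-by-weight (inj₁ (<n⇒<n+ (toℕ i) (Fin.toℕ<n (γ ⟨$⟩ʳ i))))
  ... | upper _ _   | upper _ _  = ≺-by-column (ℕ.≤-reflexive (sym j'≡1+j))
  ... | upper _ _   | last _     = ≺-by-weight (<ʷ-by-second (g≤L i) ℕ.0<1+n)

  weight-triple-upper : ∀ {i r j j'} → toℕ i < toℕ j → toℕ j ≤ n → toℕ i < toℕ j' → toℕ j' ≤ n → i ≢ r →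
                        weight (region i j) <ʷ (L r , suc (s r)) ⊎ (L r , suc (s r)) <ʷ weight (region i j')
  weight-triple-upper {i} {r} i<j j≤n i<j' j'≤n i≢r
    rewrite weight-upper i<j j≤n | weight-upper i<j' j'≤n with ℕ.<-cmp (s i) (s r)
  ... | tri< si<sr _ _ = inj₁ (upperWeight-< si<sr)
  ... | tri≈ _ si≡sr _ = ⊥-elim (i≢r (⟨$⟩ʳ-injective σ (Fin.toℕ-injective si≡sr)))
  ... | tri> _ _ sr<si = inj₂ (upperWeight-< sr<si)

  weight-triple-last : ∀ {i r j j'} → toℕ i < toℕ j → toℕ j ≤ n → toℕ j' ≡ suc n → i Fin.< r →
                       weight (region i j) <ʷ (g r , 0) ⊎ (g r , 0) <ʷ weight (region i j')
  weight-triple-last {i} {r} i<j j≤n j'≡1+n i<r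
    rewrite weight-upper i<j j≤n | weight-last {i} j'≡1+n with ℕ.<-cmp (g i) (g r)
  ... | tri< gi<gr _ _ = inj₁ (inj₁ (L<g i<r gi<gr))
  ... | tri≈ _ gi≡gr _ = ⊥-elim (Fin.<⇒≢ i<r (⟨$⟩ʳ-injective γ (Fin.toℕ-injective gi≡gr)))
  ... | tri> _ _ gr<gi = inj₂ (inj₁ gr<gi)

  weight-triple : ∀ {i r j j'} → toℕ j' ≡ suc (toℕ j) → i Fin.< r →
                  weight (region i j) <ʷ weight (region r j') ⊎ weight (region r j') <ʷ weight (region i j')
  weight-triple {i} {r} {j} {j'} j'≡1+j i<r with region r j'
  ... | lower _          = inj₁ (weight-<ʷ-lower i<r (region i j))
  ... | upper r<j' j'≤n = weight-triple-upper i<j j≤n (ℕ.<-trans i<r r<j') j'≤n (Fin.<⇒≢ i<r)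
    where
    r≤j : toℕ r ≤ toℕ j
    r≤j = s≤s⁻¹ (subst (toℕ r <_) j'≡1+j r<j')
    i<j : toℕ i < toℕ j
    i<j = ℕ.<-≤-trans i<r r≤j
    j≤n : toℕ j ≤ n
    j≤n = ℕ.≤-trans (ℕ.n≤1+n _) (subst (_≤ n) j'≡1+j j'≤n)
  ... | last j'≡1+n     = weight-triple-last i<j (ℕ.≤-reflexive j≡n) j'≡1+n i<r
    where
    j≡n : toℕ j ≡ n
    j≡n = ℕ.suc-injective (trans (sym j'≡1+j) j'≡1+n)
    i<j : toℕ i < toℕ j
    i<j = subst (toℕ i <_) (sym j≡n) (Fin.toℕ<n i)

  key-triple : ∀ {i r j j'} → toℕ j' ≡ suc (toℕ j) → i Fin.< r → key i j ≺ key r j' ⊎ key r j' ≺ key i j'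
  key-triple j'≡1+j i<r = Sum.map ≺-by-weight ≺-by-weight (weight-triple j'≡1+j i<r)

  key-column-σ : ∀ {a} → toℕ a ≡ n → ∀ {r i} → σ ⟨$⟩ʳ r Fin.< σ ⟨$⟩ʳ i → key r a ≺ key i a
  key-column-σ {a} a≡n {r} {i} σr<σi
    rewrite weight-upper {r} {a} (subst (toℕ r <_) (sym a≡n) (Fin.toℕ<n r)) (ℕ.≤-reflexive a≡n)
          | weight-upper {i} {a} (subst (toℕ i <_) (sym a≡n) (Fin.toℕ<n i)) (ℕ.≤-reflexive a≡n) =
    ≺-by-weight (upperWeight-< σr<σi)

  key-column-γ : ∀ {b} → toℕ b ≡ suc n → ∀ {r i} → γ ⟨$⟩ʳ r Fin.< γ ⟨$⟩ʳ i → key r b ≺ key i b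
  key-column-γ {b} b≡1+n {r} {i} γr<γi rewrite weight-last {r} b≡1+n | weight-last {i} b≡1+n =
    ≺-by-weight (inj₁ γr<γi)

  τ : Filling n k
  τ = standardize key

  τ-isSCT : IsSCT τ
  τ-isSCT = record
    { distinct = λ _ _ _ _ τij≡τrt → key-injective (standardize-injective key τij≡τrt)
    ; range    = standardize-range key
    ; firstCol = λ _ _ _ c≡0 i<r → standardize-≺ key (key-firstCol c≡0 i<r)
    ; rowDec   = λ i _ _ j'≡1+j → standardize-≺ key (key-rowDec i j'≡1+j)
    ; triple   = λ _ _ _ _ j'≡1+j i<r τrj'≤τij →
        Sum.[ (λ kij≺krj' → ⊥-elim (ℕ.<⇒≱ (standardize-≺ key kij≺krj') τrj'≤τij)) , standardize-≺ key ]
          (key-triple j'≡1+j i<r)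
    }

  τ-column-σ : ∀ a → toℕ a ≡ n → IsStd τ a σ
  τ-column-σ a a≡n = standardize-isStd key σ a (key-column-σ a≡n)

  τ-column-γ : ∀ b → toℕ b ≡ suc n → IsStd τ b γ
  τ-column-γ b b≡1+n = standardize-isStd key γ b (key-column-γ b≡1+n)

corollary5p8 : (n : ℕ) (σ γ : Permutation′ n) → Allowable σ γ →
    Σ ℕ (λ k → 2 ≤ k × Σ (Filling n k) (λ τ → IsSCT τ ×
      ((a b : Fin k) → suc (suc (toℕ a)) ≡ k → suc (toℕ b) ≡ k → IsStd τ a σ × IsStd τ b γ)))
corollary5p8 n σ γ allowable =
  k , s≤s (s≤s z≤n) , τ , τ-isSCT ,
  λ a b 2+a≡k 1+b≡k →
    τ-column-σ a (ℕ.suc-injective (ℕ.suc-injective 2+a≡k)) , τ-column-γ b (ℕ.suc-injective 1+b≡k)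
  where open Tableau σ γ allowable
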